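{- Let $k\in\mathbb{N}$, let $a,b\in\mathbb{N}_{+}$ with $a<b$ and $\gcd(a,b)=1$, and let $A=\{a,b\}$. If $k=0$, then the sequence $(\operatorname{sign}(S_{A,k}(n)))_{n\in\mathbb{N}}$ is eventually periodic with period $2ab$, i.e. there is $N$ such that $\operatorname{sign}(S_{A,0}(n+2ab))=\operatorname{sign}(S_{A,0}(n))$ for all $n\ge N$. If $k>0$, then the sequence $(\operatorname{sign}(S_{A,k}(n)))_{n\in\mathbb{N}}$ is eventually periodic with period $2a(b-a)$, i.e. there is $N$ such that $\operatorname{sign}(S_{A,k}(n+2a(b-a)))=\operatorname{sign}(S_{A,k}(n))$ for all $n\ge N$.
   Context: For $A\subseteq\mathbb{N}_{+}$, $c_A(i,n)$ denotes the number of partitions of $n\in\mathbb{N}$ into exactly $i$ parts, all lying in $A$ (order of parts disregarded; $c_A(0,0)=1$), and for $k\in\mathbb{N}$, $S_{A,k}(n)=\sum_{i=0}^{n}(-1)^{i}i^{k}c_A(i,n)$ (with the convention $0^0=1$). Here $\operatorname{sign}$ takes values in $\{ -1,0,1\}$. -}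

module Defs where

open import Data.Nat using (ℕ; zero; suc; _+_; _*_; _^_; _≟_)
open import Data.Integer as ℤ using (ℤ; +_; -_; 0ℤ; 1ℤ; -1ℤ)
open import Relation.Nullary using (yes; no)

-- A partition of n into parts from A = {a , b} (a ≠ b) is determined by the
-- multiplicities (x , y) of a and b; it has exactly i parts iff x + y = i,
-- and sums to n iff x * a + y * b = n.
-- c-ab a b i n = #{ x ∈ {0..i} | x * a + (i - x) * b = n }  =  c_{{a,b}}(i,n)
-- countUpTo m f  = #{ x ∈ {0..m} | f x }, here with f x = (x*a + (i∸x)*b ≡ n)

countPairs : (a b n : ℕ) → (x y : ℕ) → ℕ
-- counts pairs (x' , y') with x' ≤ x, x' + y' = x + y
countPairs a b n zero y with (y * b) ≟ n
... | yes _ = 1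
... | no _  = 0
countPairs a b n (suc x) y with (suc x * a + y * b) ≟ n
... | yes _ = suc (countPairs a b n x (suc y))
... | no _  = countPairs a b n x (suc y)

c-ab : (a b i n : ℕ) → ℕ
c-ab a b i n = countPairs a b n i 0

negOnePow : ℕ → ℤ
negOnePow zero = 1ℤ
negOnePow (suc i) = - negOnePow i

sumTo : ℕ → (ℕ → ℤ) → ℤ
sumTo zero f = f 0
sumTo (suc m) f = sumTo m f ℤ.+ f (suc m)

-- S_{A,k}(n) = Σ_{i=0}^{n} (-1)^i i^k c_A(i,n), with 0^0 = 1 (as Data.Nat._^_)
S-ab : (a b k n : ℕ) → ℤ
S-ab a b k n = sumTo n (λ i → negOnePow i ℤ.* (+ (i ^ k * c-ab a b i n)))

sign : ℤ → ℤ
sign (+ zero) = 0ℤ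
sign (+ suc _) = 1ℤ
sign ℤ.-[1+ _ ] = -1ℤ

-- The partitions of n with parts in {a, b} are the solutions of x a + y b = n, and as gcd a b = 1
-- they form a progression (x₀ + t b, y₀ - t a).  Hence the part counts i with c_A(i, n) = 1 are
-- L, L + d, …, M with d = b - a, and S_{A,k}(n) is the sum of (-1)^i i^k over them.  If d is even
-- all terms have sign (-1)^M; if d is odd and k > 0 the alternating sum of increasing powers has
-- the sign (-1)^M of its last term; if d is odd and k = 0 the sum is ((-1)^L + (-1)^M) / 2.
-- Replacing n by n + 2ae with e ≤ b adds 2e to M and, once n ≥ 2ab, keeps the set of part counts
-- nonempty or empty; replacing n by n + 2ab also adds 2a to L.  So the parities of L and M, and
-- with them the sign, repeat with period 2ab for k = 0 and 2a(b - a) for k > 0.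
module Submission where

open import Defs
open import Data.Nat using (ℕ; suc; _+_; _*_; _∸_; _<_; _≥_)
open import Data.Nat.GCD using (gcd)
open import Data.Product using (∃; _×_)
open import Relation.Binary.PropositionalEquality using (_≡_)

open import Data.Nat using (zero; _≤_; z≤n; s≤s; z<s; _≟_; _^_; _≤?_; NonZero; >-nonZero; >-nonZero⁻¹)
open import Data.Nat.Properties
open import Data.Nat.Coprimality as Coprime using (Coprime; coprime-divisor; gcd≡1⇒coprime)
open import Data.Nat.Divisibility using (_∣_; divides)
import Data.Nat.Tactic.RingSolver as ℕ-Solver
open import Data.Integer as ℤ using (ℤ; 0ℤ; 1ℤ; -1ℤ)
open import Agda.Builtin.Int using (pos)
import Data.Integer.Properties as ℤP
open import Data.Product using (Σ; _,_; proj₁; map; map₂)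
open import Data.Sum using (_⊎_; inj₁; inj₂)
open import Data.Empty using (⊥-elim)
open import Relation.Nullary using (¬_; yes; no)
import Data.Integer.Tactic.RingSolver as ℤ-Solver
open import Relation.Binary.PropositionalEquality
  using (refl; sym; trans; cong; cong₂; subst; module ≡-Reasoning)

signed : ℕ → ℕ → ℤ
signed i v = negOnePow i ℤ.* pos v

negOnePow-+ : ∀ m n → negOnePow (m + n) ≡ negOnePow m ℤ.* negOnePow n
negOnePow-+ zero    n = sym (ℤP.*-identityˡ (negOnePow n))
negOnePow-+ (suc m) n = trans (cong ℤ.-_ (negOnePow-+ m n)) (ℤP.neg-distribˡ-* (negOnePow m) (negOnePow n))

negOnePow-±1 : ∀ n → negOnePow n ≡ 1ℤ ⊎ negOnePow n ≡ -1ℤ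
negOnePow-±1 zero = inj₁ refl
negOnePow-±1 (suc n) with negOnePow-±1 n
... | inj₁ eq = inj₂ (cong ℤ.-_ eq)
... | inj₂ eq = inj₁ (cong ℤ.-_ eq)

negOnePow-2* : ∀ e → negOnePow (2 * e) ≡ 1ℤ
negOnePow-2* e = begin
  negOnePow (2 * e)              ≡⟨ cong (λ j → negOnePow (e + j)) (+-identityʳ e) ⟩
  negOnePow (e + e)              ≡⟨ negOnePow-+ e e ⟩
  negOnePow e ℤ.* negOnePow e    ≡⟨ square (negOnePow-±1 e) ⟩
  1ℤ                             ∎
  where
  open ≡-Reasoning
  square : ∀ {ε} → ε ≡ 1ℤ ⊎ ε ≡ -1ℤ → ε ℤ.* ε ≡ 1ℤ
  square (inj₁ refl) = refl
  square (inj₂ refl) = refl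

negOnePow-+-2* : ∀ m e → negOnePow (m + 2 * e) ≡ negOnePow m
negOnePow-+-2* m e = begin
  negOnePow (m + 2 * e)              ≡⟨ negOnePow-+ m (2 * e) ⟩
  negOnePow m ℤ.* negOnePow (2 * e)  ≡⟨ cong (negOnePow m ℤ.*_) (negOnePow-2* e) ⟩
  negOnePow m ℤ.* 1ℤ                 ≡⟨ ℤP.*-identityʳ (negOnePow m) ⟩
  negOnePow m                        ∎
  where open ≡-Reasoning

sign-signed : ∀ i {v} → 0 < v → sign (signed i v) ≡ negOnePow i
sign-signed i {suc v} _ with negOnePow-±1 i
... | inj₁ eq rewrite eq = refl
... | inj₂ eq rewrite eq = refl

signed-+ : ∀ i u v → signed i u ℤ.+ signed i v ≡ signed i (u + v)
signed-+ i u v = trans (sym (ℤP.*-distribˡ-+ (negOnePow i) (pos u) (pos v)))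
                       (cong (negOnePow i ℤ.*_) (sym (ℤP.pos-+ u v)))

signed-∸ : ∀ i {u v} → u ≤ v → ℤ.- signed i u ℤ.+ signed i v ≡ signed i (v ∸ u)
signed-∸ i {u} {v} u≤v = begin
  ℤ.- (ε ℤ.* pos u) ℤ.+ ε ℤ.* pos v  ≡⟨ cong (ℤ._+ ε ℤ.* pos v) (ℤP.neg-distribʳ-* ε (pos u)) ⟩
  ε ℤ.* ℤ.- pos u ℤ.+ ε ℤ.* pos v    ≡⟨ sym (ℤP.*-distribˡ-+ ε (ℤ.- pos u) (pos v)) ⟩
  ε ℤ.* (ℤ.- pos u ℤ.+ pos v)        ≡⟨ cong (ε ℤ.*_) (ℤP.+-comm (ℤ.- pos u) (pos v)) ⟩
  ε ℤ.* (pos v ℤ.+ ℤ.- pos u)        ≡⟨ cong (ε ℤ.*_) (ℤP.m-n≡m⊖n v u) ⟩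
  ε ℤ.* (v ℤ.⊖ u)                ≡⟨ cong (ε ℤ.*_) (ℤP.⊖-≥ u≤v) ⟩
  ε ℤ.* pos (v ∸ u)                ∎
  where
  open ≡-Reasoning
  ε = negOnePow i

negOnePow-opposite : ∀ i j → negOnePow j ≡ -1ℤ ℤ.* negOnePow i → negOnePow i ≡ ℤ.- negOnePow j
negOnePow-opposite i j eq = sym (trans (cong ℤ.-_ (trans eq (ℤP.-1*i≡-i (negOnePow i))))
                                           (ℤP.neg-involutive (negOnePow i)))

signed-opposite : ∀ i j v → negOnePow j ≡ -1ℤ ℤ.* negOnePow i → signed i v ≡ ℤ.- signed j v
signed-opposite i j v eq = trans (cong (ℤ._* pos v) (negOnePow-opposite i j eq))
                                     (sym (ℤP.neg-distribˡ-* (negOnePow j) (pos v)))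

Greatest : (ℕ → Set) → ℕ → Set
Greatest P M = P M × (∀ j → P j → j ≤ M)

Least : (ℕ → Set) → ℕ → Set
Least P L = P L × (∀ j → P j → L ≤ j)

least-unique : ∀ {P L L′} → Least P L → Least P L′ → L ≡ L′
least-unique (pL , minL) (pL′ , minL′) = ≤-antisym (minL _ pL′) (minL′ _ pL)

Consecutive : (ℕ → Set) → ℕ → ℕ → Set
Consecutive P i j = P i × P j × i < j × (∀ l → P l → l < j → l ≤ i)

ConsecutiveParity : (ℕ → Set) → ℤ → Set
ConsecutiveParity P ε = ∀ {i j} → Consecutive P i j → negOnePow j ≡ ε ℤ.* negOnePow i

m≤1+n⇒m≤n∨m≡1+n : ∀ {j m} → j ≤ suc m → j ≤ m ⊎ j ≡ suc m
m≤1+n⇒m≤n∨m≡1+n j≤1+m with m≤n⇒m<n∨m≡n j≤1+m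
... | inj₁ j<1+m = inj₁ (≤-pred j<1+m)
... | inj₂ j≡1+m = inj₂ j≡1+m

-- Members of P must be positive: 0 ∈ P would contribute 0 ^ k = 0 to the sum when k > 0.
module PartialSums (P : ℕ → Set) (c : ℕ → ℕ)
    (indicator : ∀ i → (P i × c i ≡ 1) ⊎ (¬ P i × c i ≡ 0))
    (P⇒positive : ∀ {i} → P i → 0 < i) where

  term : ℕ → ℕ → ℤ
  term k i = negOnePow i ℤ.* pos (i ^ k * c i)

  partialSum : ℕ → ℕ → ℤ
  partialSum k m = sumTo m (term k)

  term-present : ∀ k {i} → P i → term k i ≡ signed i (i ^ k)
  term-present k {i} p with indicator i
  ... | inj₁ (_ , ci≡1) = trans (cong (λ v → signed i (i ^ k * v)) ci≡1)
                                (cong (signed i) (*-identityʳ (i ^ k)))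
  ... | inj₂ (¬p , _)  = ⊥-elim (¬p p)

  term-absent : ∀ k {i} → ¬ P i → term k i ≡ 0ℤ
  term-absent k {i} ¬p with indicator i
  ... | inj₁ (p , _)    = ⊥-elim (¬p p)
  ... | inj₂ (_ , ci≡0) = trans (cong (λ v → signed i (i ^ k * v)) ci≡0)
                                (trans (cong (signed i) (*-zeroʳ (i ^ k))) (ℤP.*-zeroʳ (negOnePow i)))

  NoneUpTo : ℕ → Set
  NoneUpTo m = ∀ j → j ≤ m → ¬ P j

  GreatestUpTo : ℕ → ℕ → Set
  GreatestUpTo m M = P M × M ≤ m × (∀ j → P j → j ≤ m → j ≤ M)

  partialSum-none : ∀ k m → NoneUpTo m → partialSum k m ≡ 0ℤ
  partialSum-none k zero    none = term-absent k (none 0 z≤n)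
  partialSum-none k (suc m) none =
    cong₂ ℤ._+_ (partialSum-none k m (λ j j≤m → none j (m≤n⇒m≤1+n j≤m)))
                (term-absent k (none (suc m) ≤-refl))

  none-suc : ∀ {m} → NoneUpTo m → ¬ P (suc m) → NoneUpTo (suc m)
  none-suc none ¬p j j≤1+m with m≤1+n⇒m≤n∨m≡1+n j≤1+m
  ... | inj₁ j≤m  = none j j≤m
  ... | inj₂ refl = ¬p

  greatestUpTo-suc : ∀ {m M} → GreatestUpTo m M → ¬ P (suc m) → GreatestUpTo (suc m) M
  greatestUpTo-suc {m} {M} (pM , M≤m , max) ¬p = pM , m≤n⇒m≤1+n M≤m , max′
    where
    max′ : ∀ j → P j → j ≤ suc m → j ≤ M
    max′ j pj j≤1+m with m≤1+n⇒m≤n∨m≡1+n j≤1+m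
    ... | inj₁ j≤m  = max j pj j≤m
    ... | inj₂ refl = ⊥-elim (¬p pj)

  greatestUpTo-pred : ∀ {m M} → GreatestUpTo (suc m) M → ¬ P (suc m) → GreatestUpTo m M
  greatestUpTo-pred {m} (pM , M≤1+m , max) ¬p with m≤1+n⇒m≤n∨m≡1+n M≤1+m
  ... | inj₁ M≤m  = pM , M≤m , λ j pj j≤m → max j pj (m≤n⇒m≤1+n j≤m)
  ... | inj₂ refl = ⊥-elim (¬p pM)

  search : ∀ m → NoneUpTo m ⊎ Σ ℕ (GreatestUpTo m)
  search zero with indicator 0
  ... | inj₁ (p , _)  = inj₂ (0 , p , z≤n , λ _ _ j≤0 → j≤0)
  ... | inj₂ (¬p , _) = inj₁ λ { .0 z≤n → ¬p }
  search (suc m) with indicator (suc m) | search m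
  ... | inj₁ (p , _)  | _             = inj₂ (suc m , p , ≤-refl , λ _ _ j≤1+m → j≤1+m)
  ... | inj₂ (¬p , _) | inj₁ none     = inj₁ (none-suc none ¬p)
  ... | inj₂ (¬p , _) | inj₂ (M , g)  = inj₂ (M , greatestUpTo-suc g ¬p)

  consecutive-suc : ∀ {m M} → GreatestUpTo m M → P (suc m) → Consecutive P M (suc m)
  consecutive-suc (pM , M≤m , max) p = pM , p , s≤s M≤m , λ l pl l<1+m → max l pl (≤-pred l<1+m)

  module _ (I : ℕ → ℕ → Set)
      (first : ∀ m → NoneUpTo m → P (suc m) → I (suc m) (suc m))
      (next : ∀ m M → GreatestUpTo m M → I m M → P (suc m) → I (suc m) (suc m))
      (skip : ∀ m M → ¬ P (suc m) → I m M → I (suc m) M) where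

    greatestUpTo-induction : ∀ m {M} → GreatestUpTo m M → I m M
    greatestUpTo-induction zero (pM , z≤n , _) = ⊥-elim (<-irrefl refl (P⇒positive pM))
    greatestUpTo-induction (suc m) g@(_ , M≤1+m , max) with indicator (suc m)
    ... | inj₂ (¬p , _) = skip m _ ¬p (greatestUpTo-induction m (greatestUpTo-pred g ¬p))
    ... | inj₁ (p , _) = subst (I (suc m)) (≤-antisym (max (suc m) p ≤-refl) M≤1+m) present
      where
      present : I (suc m) (suc m)
      present with search m
      ... | inj₁ none      = first m none p
      ... | inj₂ (M′ , g′) = next m M′ g′ (greatestUpTo-induction m g′) p

  partialSum-suc-absent : ∀ k {m} → ¬ P (suc m) → partialSum k (suc m) ≡ partialSum k m
  partialSum-suc-absent k {m} ¬p =
    trans (cong (λ z → partialSum k m ℤ.+ z) (term-absent k ¬p)) (ℤP.+-identityʳ (partialSum k m))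

  partialSum-suc-present : ∀ k {m} → P (suc m) →
    partialSum k (suc m) ≡ partialSum k m ℤ.+ signed (suc m) (suc m ^ k)
  partialSum-suc-present k {m} p = cong (λ z → partialSum k m ℤ.+ z) (term-present k p)

  greatest⇒greatestUpTo : ∀ {m M} → (∀ j → P j → j ≤ m) → Greatest P M → GreatestUpTo m M
  greatest⇒greatestUpTo bound (pM , max) = pM , bound _ pM , λ j pj _ → max j pj

  empty-or-greatest : ∀ {m} → (∀ j → P j → j ≤ m) → (∀ j → ¬ P j) ⊎ Σ ℕ (Greatest P)
  empty-or-greatest {m} bound with search m
  ... | inj₁ none            = inj₁ λ j pj → none j (bound j pj) pj
  ... | inj₂ (M , pM , _ , max) = inj₂ (M , pM , λ j pj → max j pj (bound j pj))

  partialSum-empty : ∀ k m → (∀ j → ¬ P j) → partialSum k m ≡ 0ℤ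
  partialSum-empty k m empty = partialSum-none k m (λ j _ → empty j)

  sign-partialSum-sameParity : ConsecutiveParity P 1ℤ → ∀ k {m M} → (∀ j → P j → j ≤ m) →
    Greatest P M → sign (partialSum k m) ≡ negOnePow M
  sign-partialSum-sameParity parity k {m} {M} bound gM with
    greatestUpTo-induction Signed first next skip m (greatest⇒greatestUpTo bound gM)
    where
    Signed : ℕ → ℕ → Set
    Signed m M = Σ ℕ λ v → 0 < v × partialSum k m ≡ signed M v
    first : ∀ m → NoneUpTo m → P (suc m) → Signed (suc m) (suc m)
    first m none p = suc m ^ k , m^n>0 (suc m) k ,
      trans (partialSum-suc-present k p)
            (trans (cong (ℤ._+ signed (suc m) (suc m ^ k)) (partialSum-none k m none))
                   (ℤP.+-identityˡ _))
    next : ∀ m M → GreatestUpTo m M → Signed m M → P (suc m) → Signed (suc m) (suc m)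
    next m M g (v , 0<v , sum≡) p = v + w , <-≤-trans 0<v (m≤m+n v w) , (begin
      partialSum k (suc m)                   ≡⟨ partialSum-suc-present k p ⟩
      partialSum k m ℤ.+ signed (suc m) w    ≡⟨ cong (ℤ._+ signed (suc m) w) sum≡ ⟩
      signed M v ℤ.+ signed (suc m) w        ≡⟨ cong (λ ε → ε ℤ.* pos v ℤ.+ signed (suc m) w) same ⟩
      signed (suc m) v ℤ.+ signed (suc m) w  ≡⟨ signed-+ (suc m) v w ⟩
      signed (suc m) (v + w)                 ∎)
      where
      open ≡-Reasoning
      w = suc m ^ k
      same : negOnePow M ≡ negOnePow (suc m)
      same = sym (trans (parity (consecutive-suc g p)) (ℤP.*-identityˡ (negOnePow M)))
    skip : ∀ m M → ¬ P (suc m) → Signed m M → Signed (suc m) M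
    skip m M ¬p (v , 0<v , sum≡) = v , 0<v , trans (partialSum-suc-absent k ¬p) sum≡
  ... | v , 0<v , sum≡ = trans (cong sign sum≡) (sign-signed M 0<v)

  sign-partialSum-alternating : ConsecutiveParity P -1ℤ → ∀ {k} → 0 < k → ∀ {m M} →
    (∀ j → P j → j ≤ m) → Greatest P M → sign (partialSum k m) ≡ negOnePow M
  sign-partialSum-alternating parity {k} 0<k {m} {M} bound gM with
    greatestUpTo-induction Dominated first next skip m (greatest⇒greatestUpTo bound gM)
    where
    -- The last term outweighs the alternating sum of the smaller powers before it.
    Dominated : ℕ → ℕ → Set
    Dominated m M = Σ ℕ λ v → 0 < v × v ≤ M ^ k × partialSum k m ≡ signed M v
    first : ∀ m → NoneUpTo m → P (suc m) → Dominated (suc m) (suc m)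
    first m none p = suc m ^ k , m^n>0 (suc m) k , ≤-refl ,
      trans (partialSum-suc-present k p)
            (trans (cong (ℤ._+ signed (suc m) (suc m ^ k)) (partialSum-none k m none))
                   (ℤP.+-identityˡ _))
    next : ∀ m M → GreatestUpTo m M → Dominated m M → P (suc m) → Dominated (suc m) (suc m)
    next m M g@(_ , M≤m , _) (v , _ , v≤M^k , sum≡) p =
      w ∸ v , m<n⇒0<n∸m v<w , m∸n≤m w v , (begin
      partialSum k (suc m)                   ≡⟨ partialSum-suc-present k p ⟩
      partialSum k m ℤ.+ signed (suc m) w    ≡⟨ cong (ℤ._+ signed (suc m) w) sum≡ ⟩
      signed M v ℤ.+ signed (suc m) w        ≡⟨ cong (ℤ._+ signed (suc m) w)
                                                     (signed-opposite M (suc m) v (parity (consecutive-suc g p))) ⟩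
      ℤ.- signed (suc m) v ℤ.+ signed (suc m) w  ≡⟨ signed-∸ (suc m) (<⇒≤ v<w) ⟩
      signed (suc m) (w ∸ v)                 ∎)
      where
      open ≡-Reasoning
      w = suc m ^ k
      v<w : v < w
      v<w = ≤-<-trans v≤M^k (^-monoˡ-< k {{>-nonZero 0<k}} (s≤s M≤m))
    skip : ∀ m M → ¬ P (suc m) → Dominated m M → Dominated (suc m) M
    skip m M ¬p (v , 0<v , v≤M^k , sum≡) = v , 0<v , v≤M^k , trans (partialSum-suc-absent k ¬p) sum≡
  ... | v , 0<v , _ , sum≡ = trans (cong sign sum≡) (sign-signed M 0<v)

  double-partialSum-alternating : ConsecutiveParity P -1ℤ → ∀ {m M} →
    (∀ j → P j → j ≤ m) → Greatest P M →
    Σ ℕ λ L → Least P L × pos 2 ℤ.* partialSum 0 m ≡ negOnePow L ℤ.+ negOnePow M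
  double-partialSum-alternating parity {m} bound gM =
    greatestUpTo-induction Telescoped first next skip m (greatest⇒greatestUpTo bound gM)
    where
    Telescoped : ℕ → ℕ → Set
    Telescoped m M = Σ ℕ λ L → Least P L × pos 2 ℤ.* partialSum 0 m ≡ negOnePow L ℤ.+ negOnePow M
    first : ∀ m → NoneUpTo m → P (suc m) → Telescoped (suc m) (suc m)
    first m none p = suc m , (p , least) , (begin
      pos 2 ℤ.* partialSum 0 (suc m)              ≡⟨ cong (pos 2 ℤ.*_) (partialSum-suc-present 0 p) ⟩
      pos 2 ℤ.* (partialSum 0 m ℤ.+ ε ℤ.* pos 1)
        ≡⟨ cong (λ s → pos 2 ℤ.* (s ℤ.+ ε ℤ.* pos 1)) (partialSum-none 0 m none) ⟩
      pos 2 ℤ.* (0ℤ ℤ.+ ε ℤ.* pos 1)              ≡⟨ double ε ⟩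
      ε ℤ.+ ε                                     ∎)
      where
      open ≡-Reasoning
      ε = negOnePow (suc m)
      double : ∀ x → pos 2 ℤ.* (0ℤ ℤ.+ x ℤ.* pos 1) ≡ x ℤ.+ x
      double = ℤ-Solver.solve-∀
      least : ∀ j → P j → suc m ≤ j
      least j pj with j ≤? m
      ... | yes j≤m = ⊥-elim (none j j≤m pj)
      ... | no j≰m  = ≰⇒> j≰m
    next : ∀ m M → GreatestUpTo m M → Telescoped m M → P (suc m) → Telescoped (suc m) (suc m)
    next m M g (L , leastL , twice≡) p = L , leastL , (begin
      pos 2 ℤ.* partialSum 0 (suc m)              ≡⟨ cong (pos 2 ℤ.*_) (partialSum-suc-present 0 p) ⟩
      pos 2 ℤ.* (partialSum 0 m ℤ.+ ε ℤ.* pos 1)  ≡⟨ expand (partialSum 0 m) ε ⟩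
      pos 2 ℤ.* partialSum 0 m ℤ.+ ε ℤ.+ ε        ≡⟨ cong (λ s → s ℤ.+ ε ℤ.+ ε) twice≡ ⟩
      negOnePow L ℤ.+ negOnePow M ℤ.+ ε ℤ.+ ε     ≡⟨ cong (λ z → negOnePow L ℤ.+ z ℤ.+ ε ℤ.+ ε) opposite ⟩
      negOnePow L ℤ.+ ℤ.- ε ℤ.+ ε ℤ.+ ε           ≡⟨ cancel (negOnePow L) ε ⟩
      negOnePow L ℤ.+ ε                           ∎)
      where
      open ≡-Reasoning
      ε = negOnePow (suc m)
      opposite : negOnePow M ≡ ℤ.- ε
      opposite = negOnePow-opposite M (suc m) (parity (consecutive-suc g p))
      expand : ∀ s x → pos 2 ℤ.* (s ℤ.+ x ℤ.* pos 1) ≡ pos 2 ℤ.* s ℤ.+ x ℤ.+ x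
      expand = ℤ-Solver.solve-∀
      cancel : ∀ l x → l ℤ.+ ℤ.- x ℤ.+ x ℤ.+ x ≡ l ℤ.+ x
      cancel = ℤ-Solver.solve-∀
    skip : ∀ m M → ¬ P (suc m) → Telescoped m M → Telescoped (suc m) M
    skip m M ¬p (L , leastL , twice≡) = L , leastL , trans (cong (pos 2 ℤ.*_) (partialSum-suc-absent 0 ¬p)) twice≡

module TwoGenerators (a b : ℕ) (0<a : 0 < a) (a<b : a < b) (coprime : Coprime a b) where

  d : ℕ
  d = b ∸ a

  b≡a+d : b ≡ a + d
  b≡a+d = sym (m+[n∸m]≡n (<⇒≤ a<b))

  0<d : 0 < d
  0<d = m<n⇒0<n∸m a<b

  instance
    a≢0 : NonZero a
    a≢0 = >-nonZero 0<a
    b≢0 : NonZero b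
    b≢0 = >-nonZero (<-trans 0<a a<b)
    d≢0 : NonZero d
    d≢0 = >-nonZero 0<d


  y-antitone : ∀ {x₁ y₁ x₂ y₂} → x₁ * a + y₁ * b ≡ x₂ * a + y₂ * b → x₁ ≤ x₂ → y₂ ≤ y₁
  y-antitone {x₁} {y₁} {x₂} {y₂} eq x₁≤x₂ = *-cancelʳ-≤ y₂ y₁ b (+-cancelˡ-≤ (x₁ * a) _ _ (begin
    x₁ * a + y₂ * b  ≤⟨ +-monoˡ-≤ (y₂ * b) (*-monoˡ-≤ a x₁≤x₂) ⟩
    x₂ * a + y₂ * b  ≡⟨ sym eq ⟩
    x₁ * a + y₁ * b  ∎))
    where open ≤-Reasoning

  exchange : ∀ {x y s u} → x * a + (y + u) * b ≡ (x + s) * a + y * b → u * b ≡ s * a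
  exchange {x} {y} {s} {u} eq =
    +-cancelˡ-≡ (x * a + y * b) _ _ (trans (regroup₁ x a y b u) (trans eq (regroup₂ x a y b s)))
    where
    regroup₁ : ∀ x a y b u → x * a + y * b + u * b ≡ x * a + (y + u) * b
    regroup₁ = ℕ-Solver.solve-∀
    regroup₂ : ∀ x a y b s → (x + s) * a + y * b ≡ x * a + y * b + s * a
    regroup₂ = ℕ-Solver.solve-∀

  -- Here gcd a b = 1 is used: b divides s * a, hence s.
  trade : ∀ {x y s u} → x * a + (y + u) * b ≡ (x + s) * a + y * b → Σ ℕ λ t → s ≡ t * b × u ≡ t * a
  trade {x} {y} {s} {u} eq =
    from-divisor (coprime-divisor (Coprime.sym coprime) (divides u (trans (*-comm a s) (sym ub≡sa))))
    where
    ub≡sa : u * b ≡ s * a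
    ub≡sa = exchange {x} {y} {s} {u} eq
    from-divisor : b ∣ s → Σ ℕ λ t → s ≡ t * b × u ≡ t * a
    from-divisor (divides t s≡tb) =
      t , s≡tb , *-cancelʳ-≡ u (t * a) b (trans ub≡sa (trans (cong (_* a) s≡tb) (swap t b a)))
      where
      swap : ∀ t b a → t * b * a ≡ t * a * b
      swap = ℕ-Solver.solve-∀

  representation-step : ∀ {x₁ y₁ x₂ y₂} → x₁ * a + y₁ * b ≡ x₂ * a + y₂ * b → x₁ ≤ x₂ →
    Σ ℕ λ t → x₂ ≡ x₁ + t * b × y₁ ≡ y₂ + t * a
  representation-step {x₁} {y₁} {x₂} {y₂} eq x₁≤x₂ =
    step (m≤n⇒∃[o]m+o≡n x₁≤x₂) (m≤n⇒∃[o]m+o≡n (y-antitone {x₁} {y₁} {x₂} {y₂} eq x₁≤x₂))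
    where
    step : (Σ ℕ λ s → x₁ + s ≡ x₂) → (Σ ℕ λ u → y₂ + u ≡ y₁) →
      Σ ℕ λ t → x₂ ≡ x₁ + t * b × y₁ ≡ y₂ + t * a
    step (s , refl) (u , refl) = map₂ (map (cong (x₁ +_)) (cong (y₂ +_))) (trade {x₁} {y₂} {s} {u} eq)

  record Partition (n i : ℕ) : Set where
    constructor partition
    field
      x y   : ℕ
      parts : x + y ≡ i
      total : x * a + y * b ≡ n

  open Partition

  partition-progression : ∀ {n i j} (p : Partition n i) (q : Partition n j) → x p ≤ x q →
    Σ ℕ λ t → x q ≡ x p + t * b × y p ≡ y q + t * a × j ≡ i + t * d
  partition-progression (partition x₁ y₁ refl total₁) (partition x₂ y₂ refl total₂) x₁≤x₂ =
    progression (representation-step {x₁} {y₁} {x₂} {y₂} (trans total₁ (sym total₂)) x₁≤x₂)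
    where
    regroup : ∀ x t a d y → x + t * (a + d) + y ≡ x + (y + t * a) + t * d
    regroup = ℕ-Solver.solve-∀
    progression : (Σ ℕ λ t → x₂ ≡ x₁ + t * b × y₁ ≡ y₂ + t * a) →
      Σ ℕ λ t → x₂ ≡ x₁ + t * b × y₁ ≡ y₂ + t * a × x₂ + y₂ ≡ x₁ + y₁ + t * d
    progression (t , x₂≡ , y₁≡) = t , x₂≡ , y₁≡ , (begin
      x₂ + y₂                   ≡⟨ cong (_+ y₂) x₂≡ ⟩
      x₁ + t * b + y₂           ≡⟨ cong (λ c → x₁ + t * c + y₂) b≡a+d ⟩
      x₁ + t * (a + d) + y₂     ≡⟨ regroup x₁ t a d y₂ ⟩
      x₁ + (y₂ + t * a) + t * d ≡⟨ cong (λ y → x₁ + y + t * d) (sym y₁≡) ⟩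
      x₁ + y₁ + t * d           ∎)
      where open ≡-Reasoning

  parts-mono : ∀ {n i j} (p : Partition n i) (q : Partition n j) → x p ≤ x q → i ≤ j
  parts-mono {i = i} p q xp≤xq = mono (partition-progression p q xp≤xq)
    where
    mono : (Σ ℕ λ t → _ × _ × _ ≡ i + t * d) → i ≤ _
    mono (t , _ , _ , j≡) = subst (i ≤_) (sym j≡) (m≤m+n i (t * d))

  partition-unique-≤ : ∀ {n i} (p q : Partition n i) → x p ≤ x q → x p ≡ x q
  partition-unique-≤ {i = i} p q xp≤xq = same (partition-progression p q xp≤xq)
    where
    same : (Σ ℕ λ t → x q ≡ x p + t * b × _ × i ≡ i + t * d) → x p ≡ x q
    same (t , xq≡ , _ , i≡) = sym (begin
      x q          ≡⟨ xq≡ ⟩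
      x p + t * b  ≡⟨ cong (λ t → x p + t * b) t≡0 ⟩
      x p + 0      ≡⟨ +-identityʳ (x p) ⟩
      x p          ∎)
      where
      open ≡-Reasoning
      t≡0 : t ≡ 0
      t≡0 = m*n≡0⇒m≡0 t d (+-cancelˡ-≡ i (t * d) 0 (trans (sym i≡) (sym (+-identityʳ i))))

  partition-unique : ∀ {n i} (p q : Partition n i) → x p ≡ x q
  partition-unique p q with ≤-total (x p) (x q)
  ... | inj₁ xp≤xq = partition-unique-≤ p q xp≤xq
  ... | inj₂ xq≤xp = sym (partition-unique-≤ q p xq≤xp)

  partition-bounded : ∀ {n i} → Partition n i → i ≤ n
  partition-bounded (partition x y refl refl) = +-mono-≤ (m≤m*n x a) (m≤m*n y b)

  partition-positive : ∀ {n i} → 0 < n → Partition n i → 0 < i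
  partition-positive 0<n (partition zero zero refl refl) = 0<n
  partition-positive 0<n (partition zero (suc y) refl _) = z<s
  partition-positive 0<n (partition (suc x) y refl _) = z<s

  reindex : ∀ {n i j} → i ≡ j → Partition n i → Partition n j
  reindex i≡j p = partition (x p) (y p) (trans (parts p) i≡j) (total p)

  -- countPairs a b n x y inspects the pairs (x′ , x + y ∸ x′) for x′ ≤ x.
  Candidate : ℕ → ℕ → ℕ → Set
  Candidate n x y = Σ (Partition n (x + y)) λ p → Partition.x p ≤ x

  countPairs-indicator : ∀ n x y →
    (Candidate n x y × countPairs a b n x y ≡ 1) ⊎ (¬ Candidate n x y × countPairs a b n x y ≡ 0)
  countPairs-indicator n zero y with y * b ≟ n
  ... | yes yb≡n = inj₁ ((partition 0 y refl yb≡n , z≤n) , refl)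
  ... | no yb≢n  = inj₂ (none , refl)
    where
    none : ¬ Candidate n 0 y
    none (partition .0 y′ y′≡y total , z≤n) = yb≢n (subst (λ w → w * b ≡ n) y′≡y total)
  countPairs-indicator n (suc x) y with suc x * a + y * b ≟ n | countPairs-indicator n x (suc y)
  ... | yes found | inj₁ ((q , xq≤x) , _) =
    ⊥-elim (<⇒≱ (s≤s xq≤x) (≤-reflexive (partition-unique (partition (suc x) y (sym (+-suc x y)) found) q)))
  ... | yes found | inj₂ (_ , count≡0) = inj₁ ((partition (suc x) y refl found , ≤-refl) , cong suc count≡0)
  ... | no _      | inj₁ ((q , xq≤x) , count≡1) = inj₁ ((reindex (+-suc x y) q , m≤n⇒m≤1+n xq≤x) , count≡1)
  ... | no ¬found | inj₂ (none , count≡0) = inj₂ (none′ , count≡0)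
    where
    none′ : ¬ Candidate n (suc x) y
    none′ (q , xq≤1+x) with m≤1+n⇒m≤n∨m≡1+n xq≤1+x
    ... | inj₁ xq≤x = none (reindex (sym (+-suc x y)) q , xq≤x)
    none′ (partition .(suc x) y′ parts total , _) | inj₂ refl =
      ¬found (subst (λ w → suc x * a + w * b ≡ n) (+-cancelˡ-≡ (suc x) y′ y parts) total)

  c-ab-indicator : ∀ n i → (Partition n i × c-ab a b i n ≡ 1) ⊎ (¬ Partition n i × c-ab a b i n ≡ 0)
  c-ab-indicator n i with countPairs-indicator n i 0
  ... | inj₁ ((p , _) , count≡1) = inj₁ (reindex (+-identityʳ i) p , count≡1)
  ... | inj₂ (none , count≡0)    = inj₂ ((λ p → none (reindex (sym (+-identityʳ i)) p , x≤i p)) , count≡0)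
    where
    x≤i : ∀ {i} (p : Partition n i) → x p ≤ i
    x≤i p = subst (x p ≤_) (parts p) (m≤m+n (x p) (y p))

  retotal : ∀ {n n′ i} → n ≡ n′ → Partition n i → Partition n′ i
  retotal n≡n′ p = partition (x p) (y p) (parts p) (trans (total p) n≡n′)

  shiftˣ : ∀ {n i} s → Partition n i → Partition (n + s * a) (i + s)
  shiftˣ s p = partition (x p + s) (y p)
    (trans (regroup (x p) s (y p)) (cong (_+ s) (parts p)))
    (trans (distrib (x p) s a (y p) b) (cong (_+ s * a) (total p)))
    where
    regroup : ∀ x s y → x + s + y ≡ x + y + s
    regroup = ℕ-Solver.solve-∀
    distrib : ∀ x s a y b → (x + s) * a + y * b ≡ x * a + y * b + s * a
    distrib = ℕ-Solver.solve-∀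

  shiftʸ : ∀ {n i} s → Partition n i → Partition (n + s * b) (i + s)
  shiftʸ s p = partition (x p) (y p + s)
    (trans (sym (+-assoc (x p) (y p) s)) (cong (_+ s) (parts p)))
    (trans (distrib (x p) a (y p) s b) (cong (_+ s * b) (total p)))
    where
    distrib : ∀ x a y s b → x * a + (y + s) * b ≡ x * a + y * b + s * b
    distrib = ℕ-Solver.solve-∀

  unshiftˣ : ∀ {n j} s (q : Partition (n + s * a) j) → s ≤ x q → Σ ℕ λ i → Partition n i × j ≡ i + s
  unshiftˣ {n} s (partition x y refl total) s≤x = unshift (m≤n⇒∃[o]m+o≡n s≤x)
    where
    regroup : ∀ s r y → s + r + y ≡ r + y + s
    regroup = ℕ-Solver.solve-∀
    distrib : ∀ s r a y b → (s + r) * a + y * b ≡ r * a + y * b + s * a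
    distrib = ℕ-Solver.solve-∀
    unshift : (Σ ℕ λ r → s + r ≡ x) → Σ ℕ λ i → Partition n i × x + y ≡ i + s
    unshift (r , refl) = r + y , partition r y refl (+-cancelʳ-≡ (s * a) _ n (trans (sym (distrib s r a y b)) total)) ,
                         regroup s r y

  unshiftʸ : ∀ {n j} s (q : Partition (n + s * b) j) → s ≤ y q → Σ ℕ λ i → Partition n i × j ≡ i + s
  unshiftʸ {n} s (partition x y refl total) s≤y = unshift (m≤n⇒∃[o]m+o≡n s≤y)
    where
    regroup : ∀ x s r → x + (s + r) ≡ x + r + s
    regroup = ℕ-Solver.solve-∀
    distrib : ∀ x a s r b → x * a + (s + r) * b ≡ x * a + r * b + s * b
    distrib = ℕ-Solver.solve-∀
    unshift : (Σ ℕ λ r → s + r ≡ y) → Σ ℕ λ i → Partition n i × x + y ≡ i + s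
    unshift (r , refl) = x + r , partition x r refl (+-cancelʳ-≡ (s * b) _ n (trans (sym (distrib x a s r b)) total)) ,
                         regroup x s r

  greatest-shift : ∀ {n M} s → Greatest (Partition n) M → Greatest (Partition (n + s * a)) (M + s)
  greatest-shift {n} {M} s (p , max) = shiftˣ s p , max′
    where
    max′ : ∀ j → Partition (n + s * a) j → j ≤ M + s
    max′ j q with ≤-total (x q) (x p + s)
    ... | inj₁ xq≤ = parts-mono q (shiftˣ s p) xq≤
    ... | inj₂ ≤xq = below (unshiftˣ s q (≤-trans (m≤n+m s (x p)) ≤xq))
      where
      below : (Σ ℕ λ i → Partition n i × j ≡ i + s) → j ≤ M + s
      below (i , q′ , j≡) = subst (_≤ M + s) (sym j≡) (+-monoˡ-≤ s (max i q′))

  least-shift : ∀ {n L} s → Least (Partition n) L → Least (Partition (n + s * b)) (L + s)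
  least-shift {n} {L} s (p , min) = shiftʸ s p , min′
    where
    min′ : ∀ j → Partition (n + s * b) j → L + s ≤ j
    min′ j q with ≤-total (x p) (x q)
    ... | inj₁ xp≤ = parts-mono (shiftʸ s p) q xp≤
    ... | inj₂ xq≤ = above (partition-progression q (shiftʸ s p) xq≤)
      where
      above : (Σ ℕ λ t → _ × y q ≡ y p + s + t * a × _) → L + s ≤ j
      above (t , _ , yq≡ , _)
        with unshiftʸ s q (subst (s ≤_) (sym yq≡) (≤-trans (m≤n+m s (y p)) (m≤m+n _ (t * a))))
      ... | i , q′ , j≡ = subst (L + s ≤_) (sym j≡) (+-monoˡ-≤ s (min i q′))

  consecutive-gap : ∀ {n i j} → Consecutive (Partition n) i j → j ≡ i + d
  consecutive-gap {n} {i} {j} (p , q , i<j , between) with ≤-total (x p) (x q)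
  ... | inj₂ xq≤xp = ⊥-elim (<⇒≱ i<j (parts-mono q p xq≤xp))
  ... | inj₁ xp≤xq = gap (partition-progression p q xp≤xq)
    where
    gap : (Σ ℕ λ t → _ × y p ≡ y q + t * a × j ≡ i + t * d) → j ≡ i + d
    gap (zero , _ , _ , j≡) = ⊥-elim (<-irrefl (trans (sym (+-identityʳ i)) (sym j≡)) i<j)
    gap (suc t , _ , yp≡ , j≡) = ≤-antisym j≤i+d i+d≤j
      where
      i+d≤j : i + d ≤ j
      i+d≤j = subst (i + d ≤_) (sym j≡) (+-monoʳ-≤ i (m≤m+n d (t * d)))
      -- p with a parts equal to b replaced by b parts equal to a
      next : Partition n (i + d)
      next = partition (x p + b) (y q + t * a) (begin
        x p + b + (y q + t * a)          ≡⟨ cong (λ c → x p + c + (y q + t * a)) b≡a+d ⟩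
        x p + (a + d) + (y q + t * a)    ≡⟨ regroup (x p) a d (y q) t ⟩
        x p + (y q + suc t * a) + d      ≡⟨ cong (λ y → x p + y + d) (sym yp≡) ⟩
        x p + y p + d                    ≡⟨ cong (_+ d) (parts p) ⟩
        i + d                            ∎) (begin
        (x p + b) * a + (y q + t * a) * b  ≡⟨ exchange′ (x p) a b (y q) t ⟩
        x p * a + (y q + suc t * a) * b    ≡⟨ cong (λ y → x p * a + y * b) (sym yp≡) ⟩
        x p * a + y p * b                  ≡⟨ total p ⟩
        n                                  ∎)
        where
        open ≡-Reasoning
        regroup : ∀ x a d y t → x + (a + d) + (y + t * a) ≡ x + (y + suc t * a) + d
        regroup = ℕ-Solver.solve-∀
        exchange′ : ∀ x a b y t → (x + b) * a + (y + t * a) * b ≡ x * a + (y + suc t * a) * b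
        exchange′ = ℕ-Solver.solve-∀
      j≤i+d : j ≤ i + d
      j≤i+d = ≮⇒≥ λ i+d<j → <⇒≱ (m<m+n i 0<d) (between (i + d) next i+d<j)

  consecutive-parity : ∀ n → ConsecutiveParity (Partition n) (negOnePow d)
  consecutive-parity n {i} {j} consecutive = begin
    negOnePow j                       ≡⟨ cong negOnePow (consecutive-gap consecutive) ⟩
    negOnePow (i + d)                 ≡⟨ negOnePow-+ i d ⟩
    negOnePow i ℤ.* negOnePow d       ≡⟨ ℤP.*-comm (negOnePow i) (negOnePow d) ⟩
    negOnePow d ℤ.* negOnePow i       ∎
    where open ≡-Reasoning

  -- For n ≥ 2ab a partition of n + 2ae has at least 2e parts a, or at least 2a parts b.
  period-unshift : ∀ {n e f j} → e + f ≡ b → 2 * a * b ≤ n →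
    Partition (n + 2 * a * e) j → Σ ℕ (Partition n)
  period-unshift {n} {e} {f} e+f≡b 2ab≤n q with 2 * e ≤? x q | 2 * a ≤? y q
  ... | yes 2e≤x | _ = map₂ proj₁ (unshiftˣ (2 * e) (retotal (cong (n +_) (rearrange a e)) q) 2e≤x)
    where
    rearrange : ∀ a e → 2 * a * e ≡ 2 * e * a
    rearrange = ℕ-Solver.solve-∀
  ... | no _ | yes 2a≤y = swap-b (m≤n⇒∃[o]m+o≡n 2a≤y)
    where
    swap-b : (Σ ℕ λ r → 2 * a + r ≡ y q) → Σ ℕ (Partition n)
    swap-b (r , 2a+r≡y) = x q + 2 * f + r , partition (x q + 2 * f) r refl
      (+-cancelʳ-≡ (2 * a * e) _ n (begin
        (x q + 2 * f) * a + r * b + 2 * a * e   ≡⟨ regroup ⟩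
        x q * a + (2 * a + r) * b               ≡⟨ cong (λ y → x q * a + y * b) 2a+r≡y ⟩
        x q * a + y q * b                       ≡⟨ total q ⟩
        n + 2 * a * e                           ∎))
      where
      open ≡-Reasoning
      identity : ∀ x f a r e → (x + 2 * f) * a + r * (e + f) + 2 * a * e ≡ x * a + (2 * a + r) * (e + f)
      identity = ℕ-Solver.solve-∀
      regroup : (x q + 2 * f) * a + r * b + 2 * a * e ≡ x q * a + (2 * a + r) * b
      regroup = subst (λ c → (x q + 2 * f) * a + r * c + 2 * a * e ≡ x q * a + (2 * a + r) * c)
                      e+f≡b (identity (x q) f a r e)
  ... | no x<2e | no y<2a = ⊥-elim (<-irrefl refl (begin-strict
    n + 2 * a * e                ≡⟨ sym (total q) ⟩
    x q * a + y q * b            <⟨ +-mono-< (*-monoˡ-< a (≰⇒> x<2e)) (*-monoˡ-< b (≰⇒> y<2a)) ⟩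
    2 * e * a + 2 * a * b        ≡⟨ rearrange a b e ⟩
    2 * a * e + 2 * a * b        ≤⟨ +-monoʳ-≤ (2 * a * e) 2ab≤n ⟩
    2 * a * e + n                ≡⟨ +-comm (2 * a * e) n ⟩
    n + 2 * a * e                ∎))
    where
    open ≤-Reasoning
    rearrange : ∀ a b e → 2 * e * a + 2 * a * b ≡ 2 * a * e + 2 * a * b
    rearrange = ℕ-Solver.solve-∀

  module Sums (n : ℕ) (0<n : 0 < n) =
    PartialSums (Partition n) (λ i → c-ab a b i n) (c-ab-indicator n) (partition-positive 0<n)

  0<2ab : 0 < 2 * a * b
  0<2ab = >-nonZero⁻¹ (2 * a * b) {{m*n≢0 (2 * a) b {{m*n≢0 2 a}}}}

  large⇒positive : ∀ {n} → 2 * a * b ≤ n → 0 < n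
  large⇒positive = <-≤-trans 0<2ab

  period-dichotomy : ∀ {n e} → e ≤ b → 2 * a * b ≤ n →
    ((∀ j → ¬ Partition n j) × (∀ j → ¬ Partition (n + 2 * a * e) j))
    ⊎ (Σ ℕ λ M → Greatest (Partition n) M × Greatest (Partition (n + 2 * a * e)) (M + 2 * e))
  period-dichotomy {n} {e} e≤b 2ab≤n
    with Sums.empty-or-greatest n (large⇒positive 2ab≤n) (λ _ → partition-bounded)
  ... | inj₁ empty = inj₁ (empty , λ j q → remainder (m≤n⇒∃[o]m+o≡n e≤b) q)
    where
    remainder : (Σ ℕ λ f → e + f ≡ b) → ∀ {j} → ¬ Partition (n + 2 * a * e) j
    remainder (f , e+f≡b) q with period-unshift e+f≡b 2ab≤n q
    ... | i , p = empty i p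
  ... | inj₂ (M , gM) = inj₂ (M , gM ,
    subst (λ m → Greatest (Partition m) (M + 2 * e)) (cong (n +_) (rearrange e a)) (greatest-shift (2 * e) gM))
    where
    rearrange : ∀ e a → 2 * e * a ≡ 2 * a * e
    rearrange = ℕ-Solver.solve-∀

  EventuallyPeriodic : ℕ → ℕ → Set
  EventuallyPeriodic k T = ∃ λ N → ∀ n → n ≥ N → sign (S-ab a b k (n + T)) ≡ sign (S-ab a b k n)

  SignOfGreatest : ℕ → Set
  SignOfGreatest k = ∀ {n M} → 0 < n → Greatest (Partition n) M → sign (S-ab a b k n) ≡ negOnePow M

  ShiftPreservesSign : ℕ → ℕ → Set
  ShiftPreservesSign k e = ∀ {n M} → 2 * a * b ≤ n →
    Greatest (Partition n) M → Greatest (Partition (n + 2 * a * e)) (M + 2 * e) →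
    sign (S-ab a b k (n + 2 * a * e)) ≡ sign (S-ab a b k n)

  sign-of-greatest-sameParity : negOnePow d ≡ 1ℤ → ∀ k → SignOfGreatest k
  sign-of-greatest-sameParity d-even k {n} 0<n =
    Sums.sign-partialSum-sameParity n 0<n (subst (ConsecutiveParity (Partition n)) d-even (consecutive-parity n))
      k (λ _ → partition-bounded)

  sign-of-greatest-alternating : negOnePow d ≡ -1ℤ → ∀ {k} → 0 < k → SignOfGreatest k
  sign-of-greatest-alternating d-odd 0<k {n} 0<n =
    Sums.sign-partialSum-alternating n 0<n (subst (ConsecutiveParity (Partition n)) d-odd (consecutive-parity n))
      0<k (λ _ → partition-bounded)

  sign-of-greatest : ∀ {k} → 0 < k → SignOfGreatest k
  sign-of-greatest {k} 0<k with negOnePow-±1 d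
  ... | inj₁ d-even = sign-of-greatest-sameParity d-even k
  ... | inj₂ d-odd  = sign-of-greatest-alternating d-odd 0<k

  periodic-from-shift : ∀ k {e} → e ≤ b → ShiftPreservesSign k e → EventuallyPeriodic k (2 * a * e)
  periodic-from-shift k {e} e≤b shifted = 2 * a * b , periodic
    where
    periodic : ∀ n → n ≥ 2 * a * b → sign (S-ab a b k (n + 2 * a * e)) ≡ sign (S-ab a b k n)
    periodic n 2ab≤n with period-dichotomy e≤b 2ab≤n
    ... | inj₂ (M , gM , gM′) = shifted 2ab≤n gM gM′
    ... | inj₁ (empty , empty′) = cong sign (trans
          (Sums.partialSum-empty (n + 2 * a * e) (<-≤-trans 0<n (m≤m+n n _)) k (n + 2 * a * e) empty′)
          (sym (Sums.partialSum-empty n 0<n k n empty)))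
      where
      0<n = large⇒positive 2ab≤n

  periodic-from-signOfGreatest : ∀ k {e} → e ≤ b → SignOfGreatest k → EventuallyPeriodic k (2 * a * e)
  periodic-from-signOfGreatest k {e} e≤b sign≡ = periodic-from-shift k e≤b shifted
    where
    shifted : ShiftPreservesSign k e
    shifted {n} {M} 2ab≤n gM gM′ = begin
      sign (S-ab a b k (n + 2 * a * e))  ≡⟨ sign≡ (<-≤-trans 0<n (m≤m+n n _)) gM′ ⟩
      negOnePow (M + 2 * e)              ≡⟨ negOnePow-+-2* M e ⟩
      negOnePow M                        ≡⟨ sign≡ 0<n gM ⟨
      sign (S-ab a b k n)                ∎
      where
      open ≡-Reasoning
      0<n = large⇒positive 2ab≤n

  -- Both ends of the progression of part counts move by an even amount, so S_{A,0} itself is periodic.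
  periodic-0-alternating : negOnePow d ≡ -1ℤ → EventuallyPeriodic 0 (2 * a * b)
  periodic-0-alternating d-odd = periodic-from-shift 0 ≤-refl shifted
    where
    alternating : ∀ n → ConsecutiveParity (Partition n) -1ℤ
    alternating n = subst (ConsecutiveParity (Partition n)) d-odd (consecutive-parity n)
    shifted : ShiftPreservesSign 0 b
    shifted {n} {M} 2ab≤n gM gM′
      with Sums.double-partialSum-alternating n 0<n (alternating n) (λ _ → partition-bounded) gM
         | Sums.double-partialSum-alternating n′ 0<n′ (alternating n′) (λ _ → partition-bounded) gM′
      where
      n′ = n + 2 * a * b
      0<n = large⇒positive 2ab≤n
      0<n′ = <-≤-trans 0<n (m≤m+n n _)
    ... | L , leastL , twice | L′ , leastL′ , twice′ = cong sign (ℤP.*-cancelˡ-≡ (pos 2) _ _ (begin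
      pos 2 ℤ.* S-ab a b 0 (n + 2 * a * b)              ≡⟨ twice′ ⟩
      negOnePow L′ ℤ.+ negOnePow (M + 2 * b)           ≡⟨ cong (λ l → negOnePow l ℤ.+ _) L′≡ ⟩
      negOnePow (L + 2 * a) ℤ.+ negOnePow (M + 2 * b)  ≡⟨ cong₂ ℤ._+_ (negOnePow-+-2* L a) (negOnePow-+-2* M b) ⟩
      negOnePow L ℤ.+ negOnePow M                      ≡⟨ twice ⟨
      pos 2 ℤ.* S-ab a b 0 n                           ∎))
      where
      open ≡-Reasoning
      L′≡ : L′ ≡ L + 2 * a
      L′≡ = least-unique leastL′ (least-shift (2 * a) leastL)

  periodic-0 : EventuallyPeriodic 0 (2 * a * b)
  periodic-0 with negOnePow-±1 d
  ... | inj₁ d-even = periodic-from-signOfGreatest 0 ≤-refl (sign-of-greatest-sameParity d-even 0)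
  ... | inj₂ d-odd  = periodic-0-alternating d-odd

  periodic-positive : ∀ {k} → 0 < k → EventuallyPeriodic k (2 * a * d)
  periodic-positive {k} 0<k = periodic-from-signOfGreatest k (m∸n≤m b a) (sign-of-greatest 0<k)

mainTheorem10 : (k a b : ℕ) → 0 < a → a < b → gcd a b ≡ 1 →
    (k ≡ 0 → ∃ λ N → ∀ n → n ≥ N →
      sign (S-ab a b k (n + 2 * a * b)) ≡ sign (S-ab a b k n))
    × (0 < k → ∃ λ N → ∀ n → n ≥ N →
      sign (S-ab a b k (n + 2 * a * (b ∸ a))) ≡ sign (S-ab a b k n))
mainTheorem10 k a b 0<a a<b gcd≡1 = (λ { refl → periodic-0 }) , periodic-positive
  where open TwoGenerators a b 0<a a<b (gcd≡1⇒coprime gcd≡1)
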